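{- Let $\mathscr{A}$ be a closed set of games with $\mathscr{A}\neq\emptyset$ and $\mathscr{A}\neq\{0\}$ whose mis\`ere quotient $(\mathcal{Q},\mathcal{P})=\mathcal{Q}(\mathscr{A})$ is finite. Let $z$ be the product of all idempotents of $\mathcal{Q}$ and $\mathcal{K}$ the mutual divisibility class of $z$. Then $\mathcal{K}\cap\mathcal{P}\neq\emptyset$.
   Context: Games are finite, loopfree impartial games identified with their sets of options ($0=\{\}$); disjunctive sum $G+H=\{G'+H\}\cup\{G+H'\}$. Mis\`ere outcome: $o^-(G)=\mathscr{P}$ iff $G\neq0$ and every option has outcome $\mathscr{N}$; otherwise $\mathscr{N}$. A set of games is closed if closed under sum and under taking options. For $G,H\in\mathscr{A}$, $G\equiv_\mathscr{A}H$ iff $o^-(G+X)=o^-(H+X)$ for all $X\in\mathscr{A}$. The mis\`ere quotient is $\mathcal{Q}=\mathscr{A}/\!\equiv_\mathscr{A}$, a commutative monoid under $[G][H]=[G+H]$, with $\mathcal{P}=\{[G]:o^-(G)=\mathscr{P}\}$. In a commutative monoid, $x$ divides $y$ if $xw=y$ for some $w$; $x,y$ are mutually divisible if each divides the other; an idempotent is $x$ with $x^2=x$. -}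

module Defs where

open import Data.Nat using (ℕ)
open import Data.Fin using (Fin)
open import Data.List using (List; []; _∷_; _++_)
open import Data.Bool using (Bool; true; false; not; _∧_)
open import Data.Product using (Σ; ∃; _×_; _,_)
open import Data.List.Membership.Propositional using (_∈_)
open import Relation.Binary.PropositionalEquality using (_≡_; _≢_)
open import Relation.Nullary using (¬_)

-- Finite loopfree impartial games as finite rose trees of options.
-- A game is identified with its (finite) list of options; all notions below
-- (outcome, sum, equivalence) are invariant under reordering/duplication.
data Game : Set where
  node : List Game → Game

options : Game → List Game
options (node gs) = gs

zeroG : Game
zeroG = node []

mutual
  _⊕_ : Game → Game → Game
  node gs ⊕ node hs = node (leftOpts gs (node hs) ++ rightOpts (node gs) hs)

  leftOpts : List Game → Game → List Game
  leftOpts [] h = []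
  leftOpts (g ∷ gs) h = (g ⊕ h) ∷ leftOpts gs h

  rightOpts : Game → List Game → List Game
  rightOpts g [] = []
  rightOpts g (h ∷ hs) = (g ⊕ h) ∷ rightOpts g hs

infixl 6 _⊕_

data Outcome : Set where
  𝒫 𝒩 : Outcome

mutual
  isP : Game → Bool
  isP (node []) = false
  isP (node (g ∷ gs)) = allN (g ∷ gs)

  allN : List Game → Bool
  allN [] = true
  allN (g ∷ gs) = not (isP g) ∧ allN gs

o⁻ : Game → Outcome
o⁻ G with isP G
... | true = 𝒫
... | false = 𝒩

GameSet : Set₁
GameSet = Game → Set

Closed : GameSet → Set
Closed 𝒜 = (∀ G H → 𝒜 G → 𝒜 H → 𝒜 (G ⊕ H))
         × (∀ G G′ → 𝒜 G → G′ ∈ options G → 𝒜 G′)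

_≡[_]_ : Game → GameSet → Game → Set
G ≡[ 𝒜 ] H = ∀ X → 𝒜 X → o⁻ (G ⊕ X) ≡ o⁻ (H ⊕ X)

FiniteQuotient : GameSet → Set
FiniteQuotient 𝒜 = Σ ℕ λ n → Σ (Fin n → Game) λ r →
  (∀ i → 𝒜 (r i)) × (∀ G → 𝒜 G → ∃ λ i → G ≡[ 𝒜 ] r i)

Idempotent : GameSet → Game → Set
Idempotent 𝒜 G = (G ⊕ G) ≡[ 𝒜 ] G

Divides : GameSet → Game → Game → Set
Divides 𝒜 G H = ∃ λ W → 𝒜 W × (G ⊕ W) ≡[ 𝒜 ] H

MutuallyDivisible : GameSet → Game → Game → Set
MutuallyDivisible 𝒜 G H = Divides 𝒜 G H × Divides 𝒜 H G

-- sum of a finite family of games (representing a product in 𝒬)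
sumFin : (k : ℕ) → (Fin k → Game) → Game
sumFin ℕ.zero e = zeroG
sumFin (ℕ.suc k) e = e Fin.zero ⊕ sumFin k (λ i → e (Fin.suc i))

IdempotentEnumeration : GameSet → (k : ℕ) → (Fin k → Game) → Set
IdempotentEnumeration 𝒜 k e =
    (∀ i → 𝒜 (e i) × Idempotent 𝒜 (e i))
  × (∀ i j → e i ≡[ 𝒜 ] e j → i ≡ j)
  × (∀ G → 𝒜 G → Idempotent 𝒜 G → ∃ λ i → G ≡[ 𝒜 ] e i)

{-# OPTIONS --safe #-}
module Submission where

-- The sum z of all idempotents absorbs every idempotent, and some multiple (m+1)·y of any y is
-- idempotent (pigeonhole on the multiples of y in the finite quotient); so z + y divides z, and
-- z + y lies in the class 𝒦 of z for every y. It remains to make z + y a P-position: if z = 0 take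
-- any P-position of 𝒜 (one exists because 𝒜 ≠ {0}); if z + z is a P-position take y = z; otherwise
-- z + z ≠ 0 has a P-position option, of the form z′ + z or z + z′ with z′ an option of z.

open import Defs
open import Algebra.Bundles using (Monoid; CommutativeMonoid)
open import Algebra.Structures.Biased using (isCommutativeMonoidˡ)
open import Data.Bool using (true; false)
open import Data.Empty using (⊥-elim)
open import Data.Fin using (Fin; toℕ)
open import Data.Fin.Properties using (pigeonhole)
open import Data.List using (List; []; _∷_; _++_; map)
open import Data.List.Properties using (map-++; map-∘; map-id; ++-assoc)
open import Data.List.Relation.Unary.Any using (here; there)
open import Data.List.Relation.Binary.Subset.Propositional using (_⊆_)
open import Data.List.Membership.Propositional using (_∈_)
open import Data.List.Membership.Propositional.Properties using (∈-map⁺; ∈-map⁻; ∈-++⁺ˡ; ∈-++⁺ʳ; ∈-++⁻)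
open import Data.Nat using (ℕ; zero; suc; _+_; _*_)
open import Data.Nat.Properties using (+-identityʳ; +-suc; n<1+n; m≤n⇒∃[o]m+o≡n)
open import Data.Nat.Tactic.RingSolver using (solve-∀)
open import Data.Product using (Σ; ∃; ∃₂; _×_; _,_; proj₁; proj₂)
open import Data.Sum using (_⊎_; inj₁; inj₂)
open import Data.Vec.Functional using (Vector; removeAt)
open import Function using (_∘_; _on_; flip; case_of_)
open import Induction.WellFounded using (WellFounded; Acc; acc; WfRec; module All)
open import Level using (Level; 0ℓ)
open import Relation.Binary.Bundles using (Setoid)
import Relation.Binary.Construct.On as On
import Relation.Binary.PropositionalEquality as ≡
open ≡ using (_≡_; _≢_; refl; cong; cong₂; subst; subst₂; module ≡-Reasoning)

private variable
  c ℓ : Level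
  A B C D : Set

module _ (M : Monoid c ℓ) where

  open Monoid M
  open import Algebra.Definitions _≈_ using (_IdempotentOn_)
  open import Algebra.Properties.Monoid.Mult M using (×-congˡ; ×-homo-+) renaming (_×_ to _·_)
  open import Relation.Binary.Reasoning.Setoid setoid

  ·-shift : ∀ {x} a p → a · x ≈ (a + p) · x → ∀ s → (a + s) · x ≈ (a + p + s) · x
  ·-shift {x} a p repeat s = begin
    (a + s) · x         ≈⟨ ×-homo-+ x a s ⟩
    a · x ∙ s · x       ≈⟨ ∙-congʳ repeat ⟩
    (a + p) · x ∙ s · x ≈⟨ ×-homo-+ x (a + p) s ⟨
    (a + p + s) · x     ∎

  ·-shift-multiple : ∀ {x} a p → a · x ≈ (a + p) · x → ∀ q s → (a + s) · x ≈ (a + q * p + s) · x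
  ·-shift-multiple     a p repeat zero    s = ×-congˡ (≡.cong (_+ s) (≡.sym (+-identityʳ a)))
  ·-shift-multiple {x} a p repeat (suc q) s = begin
    (a + s) · x                 ≈⟨ ·-shift-multiple a p repeat q s ⟩
    (a + q * p + s) · x         ≈⟨ ×-congˡ (reassoc₁ a p q s) ⟩
    (a + (q * p + s)) · x       ≈⟨ ·-shift a p repeat (q * p + s) ⟩
    (a + p + (q * p + s)) · x   ≈⟨ ×-congˡ (reassoc₂ a p q s) ⟩
    (a + suc q * p + s) · x     ∎
    where
    reassoc₁ : ∀ a p q s → a + q * p + s ≡ a + (q * p + s)
    reassoc₁ = solve-∀
    reassoc₂ : ∀ a p q s → a + p + (q * p + s) ≡ a + suc q * p + s
    reassoc₂ = solve-∀

  -- a + a·p = a·(p+1) is a multiple of the period p+1 beyond the preperiod a.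
  repeat⇒idempotent : ∀ {x} a p → a · x ≈ (a + suc p) · x → _∙_ IdempotentOn ((a + a * p) · x)
  repeat⇒idempotent {x} a p repeat = begin
    m · x ∙ m · x                ≈⟨ ×-homo-+ x m m ⟨
    (m + m) · x                  ≈⟨ ×-congˡ (double a p) ⟩
    (a + a * suc p + a * p) · x  ≈⟨ ·-shift-multiple a (suc p) repeat a (a * p) ⟨
    m · x                        ∎
    where
    m : ℕ
    m = a + a * p
    double : ∀ a p → (a + a * p) + (a + a * p) ≡ a + a * suc p + a * p
    double = solve-∀

  module _ {n} (r : Vector Carrier n) (covers : ∀ y → ∃ λ i → y ≈ r i) where

    class : Carrier → Fin n
    class y = proj₁ (covers y)

    multiples-repeat : ∀ x → ∃₂ λ a p → suc a · x ≈ (suc a + suc p) · x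
    multiples-repeat x
      with i , j , i<j , same-class ← pigeonhole (n<1+n n) (λ k → class (suc (toℕ k) · x))
      with p , i+p≡j ← m≤n⇒∃[o]m+o≡n i<j
      = toℕ i , p , (begin
          suc (toℕ i) · x            ≈⟨ proj₂ (covers _) ⟩
          r (class _)                ≡⟨ ≡.cong r same-class ⟩
          r (class _)                ≈⟨ proj₂ (covers _) ⟨
          suc (toℕ j) · x            ≡⟨ ≡.cong (λ m → suc m · x) i+p≡j ⟨
          suc (suc (toℕ i) + p) · x  ≡⟨ ≡.cong (_· x) (+-suc (suc (toℕ i)) p) ⟨
          (suc (toℕ i) + suc p) · x  ∎)

    idempotent-multiple : ∀ x → ∃ λ m → _∙_ IdempotentOn (suc m · x)
    idempotent-multiple x =
      let a , p , repeat = multiples-repeat x in a + suc a * p , repeat⇒idempotent (suc a) p repeat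

module _ (M : CommutativeMonoid c ℓ) where

  open CommutativeMonoid M
  open import Algebra.Definitions _≈_ using (_IdempotentOn_)
  open import Algebra.Definitions.RawMagma rawMagma using (_∣ˡ_; _,_)
  open import Algebra.Properties.CommutativeMonoid.Sum M using (sum; sum-remove)
  open import Algebra.Properties.CommutativeSemigroup commutativeSemigroup using (xy∙z≈xz∙y)
  open import Algebra.Properties.Monoid.Mult monoid using () renaming (_×_ to _·_)
  open import Relation.Binary.Reasoning.Setoid setoid

  sum-absorbs-idempotent : ∀ {k} (e : Vector Carrier k) i {u} →
                           _∙_ IdempotentOn u → u ≈ e i → sum e ∙ u ≈ sum e
  sum-absorbs-idempotent {suc k} e i {u} idem u≈eᵢ = begin
    sum e ∙ u         ≈⟨ ∙-congʳ (sum-remove e) ⟩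
    (e i ∙ rest) ∙ u  ≈⟨ ∙-congʳ (∙-congʳ u≈eᵢ) ⟨
    (u ∙ rest) ∙ u    ≈⟨ xy∙z≈xz∙y u rest u ⟩
    (u ∙ u) ∙ rest    ≈⟨ ∙-congʳ idem ⟩
    u ∙ rest          ≈⟨ ∙-congʳ u≈eᵢ ⟩
    e i ∙ rest        ≈⟨ sum-remove e ⟨
    sum e             ∎
    where
    rest : Carrier
    rest = sum (removeAt e i)

  module IdempotentSum {n} (r : Vector Carrier n) (covers : ∀ y → ∃ λ i → y ≈ r i)
                       {k} (e : Vector Carrier k) (e-complete : ∀ u → _∙_ IdempotentOn u → ∃ λ i → u ≈ e i) where

    z : Carrier
    z = sum e

    z∙y∣ˡz : ∀ y → (z ∙ y) ∣ˡ z
    z∙y∣ˡz y with m , idem ← idempotent-multiple monoid r covers y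
             with i , yᵐ⁺¹≈eᵢ ← e-complete (suc m · y) idem
      = m · y , (begin
        (z ∙ y) ∙ m · y  ≈⟨ assoc z y (m · y) ⟩
        z ∙ suc m · y    ≈⟨ sum-absorbs-idempotent e i idem yᵐ⁺¹≈eᵢ ⟩
        z                ∎)

Sim : (A → B → Set) → List A → List B → Set
Sim R xs ys = ∀ {x} → x ∈ xs → ∃ λ y → y ∈ ys × R x y

ListBisim : (A → B → Set) → List A → List B → Set
ListBisim R xs ys = Sim R xs ys × Sim (flip R) ys xs

Sim-++ : ∀ {R : A → B → Set} {xs xs′ zs} → Sim R xs zs → Sim R xs′ zs → Sim R (xs ++ xs′) zs
Sim-++ {xs = xs} sim sim′ x∈ with ∈-++⁻ xs x∈
... | inj₁ x∈xs  = sim x∈xs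
... | inj₂ x∈xs′ = sim′ x∈xs′

Sim-⊆ : ∀ {R : A → B → Set} {xs ys zs} → Sim R xs ys → ys ⊆ zs → Sim R xs zs
Sim-⊆ sim ys⊆zs x∈ = let y , y∈ , r = sim x∈ in y , ys⊆zs y∈ , r

Sim-map : ∀ {R : A → B → Set} {S : C → D → Set} {f : A → C} {g : B → D} {xs ys} →
          (∀ {x y} → x ∈ xs → y ∈ ys → R x y → S (f x) (g y)) →
          Sim R xs ys → Sim S (map f xs) (map g ys)
Sim-map {g = g} h sim fx∈ with ∈-map⁻ _ fx∈
... | x , x∈ , refl = let y , y∈ , r = sim x∈ in g y , ∈-map⁺ g y∈ , h x∈ y∈ r

ListBisim-++ : ∀ {R : A → B → Set} {xs xs′ ys ys′} →
               ListBisim R xs ys → ListBisim R xs′ ys′ → ListBisim R (xs ++ xs′) (ys ++ ys′)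
ListBisim-++ {xs = xs} {ys = ys} (fw , bw) (fw′ , bw′) =
  Sim-++ (Sim-⊆ fw ∈-++⁺ˡ) (Sim-⊆ fw′ (∈-++⁺ʳ ys)) ,
  Sim-++ (Sim-⊆ bw ∈-++⁺ˡ) (Sim-⊆ bw′ (∈-++⁺ʳ xs))

ListBisim-++-swap : ∀ {R : A → B → Set} {xs xs′ ys ys′} →
                    ListBisim R xs ys′ → ListBisim R xs′ ys → ListBisim R (xs ++ xs′) (ys ++ ys′)
ListBisim-++-swap {xs = xs} {ys = ys} (fw , bw) (fw′ , bw′) =
  Sim-++ (Sim-⊆ fw (∈-++⁺ʳ ys)) (Sim-⊆ fw′ ∈-++⁺ˡ) ,
  Sim-++ (Sim-⊆ bw′ (∈-++⁺ʳ xs)) (Sim-⊆ bw ∈-++⁺ˡ)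

ListBisim-map : ∀ {R : A → B → Set} {S : C → D → Set} {f : A → C} {g : B → D} {xs ys} →
                (∀ {x y} → x ∈ xs → y ∈ ys → R x y → S (f x) (g y)) →
                ListBisim R xs ys → ListBisim S (map f xs) (map g ys)
ListBisim-map h (fw , bw) = Sim-map h fw , Sim-map (λ y∈ x∈ → h x∈ y∈) bw

ListBisim-refl : ∀ {R : A → A → Set} {xs} → (∀ {x} → x ∈ xs → R x x) → ListBisim R xs xs
ListBisim-refl r = (λ x∈ → _ , x∈ , r x∈) , (λ x∈ → _ , x∈ , r x∈)

ListBisim-pointwise : ∀ {R : B → B → Set} {f g : A → B} {xs} →
                      (∀ {x} → x ∈ xs → R (f x) (g x)) → ListBisim R (map f xs) (map g xs)
ListBisim-pointwise r = ListBisim-map (λ { x∈ _ refl → r x∈ }) (ListBisim-refl {R = _≡_} λ _ → refl)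

infix 4 _≺_

_≺_ : Game → Game → Set
g ≺ G = g ∈ options G

≺-wellFounded : WellFounded _≺_
≺-wellFounded G = acc (options-accessible G)
  where
  options-accessible : ∀ G → WfRec _≺_ (Acc _≺_) G
  options-accessible (node (g ∷ gs)) (here refl) = ≺-wellFounded g
  options-accessible (node (g ∷ gs)) (there g′∈) = options-accessible (node gs) g′∈

open All ≺-wellFounded 0ℓ renaming (wfRec to game-induction)

-- ⊕ is commutative and associative only up to ≅, which identifies games whose option lists agree
-- up to order and repetition, recursively.

infix 4 _≅_

data _≅_ : Game → Game → Set where
  node : ∀ {gs hs} → ListBisim _≅_ gs hs → node gs ≅ node hs

≅-options : ∀ {G H} → G ≅ H → ListBisim _≅_ (options G) (options H)
≅-options (node bisim) = bisim

≅-intro : ∀ {G H} → ListBisim _≅_ (options G) (options H) → G ≅ H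
≅-intro {node gs} {node hs} bisim = node bisim

options-⊕ : ∀ G H → options (G ⊕ H) ≡ map (_⊕ H) (options G) ++ map (G ⊕_) (options H)
options-⊕ (node gs) (node hs) = cong₂ _++_ (leftOpts-map gs) (rightOpts-map hs)
  where
  leftOpts-map : ∀ gs′ → leftOpts gs′ (node hs) ≡ map (_⊕ node hs) gs′
  leftOpts-map []        = refl
  leftOpts-map (g ∷ gs′) = cong (g ⊕ node hs ∷_) (leftOpts-map gs′)
  rightOpts-map : ∀ hs′ → rightOpts (node gs) hs′ ≡ map (node gs ⊕_) hs′
  rightOpts-map []        = refl
  rightOpts-map (h ∷ hs′) = cong (node gs ⊕ h ∷_) (rightOpts-map hs′)

≅-intro-⊕ : ∀ {G H G′ H′} →
            ListBisim _≅_ (map (_⊕ H) (options G) ++ map (G ⊕_) (options H))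
                          (map (_⊕ H′) (options G′) ++ map (G′ ⊕_) (options H′)) →
            G ⊕ H ≅ G′ ⊕ H′
≅-intro-⊕ {G} {H} {G′} {H′} = ≅-intro ∘ subst₂ (ListBisim _≅_) (≡.sym (options-⊕ G H)) (≡.sym (options-⊕ G′ H′))

≅-refl : ∀ G → G ≅ G
≅-refl = game-induction _ λ G ih → ≅-intro (ListBisim-refl ih)

⊕-comm : ∀ G H → G ⊕ H ≅ H ⊕ G
⊕-comm = game-induction _ λ G ih-G → game-induction _ λ H ih-H →
  ≅-intro-⊕ (ListBisim-++-swap (ListBisim-pointwise λ g∈ → ih-G g∈ H)
                               (ListBisim-pointwise ih-H))

⊕-identityˡ : ∀ G → zeroG ⊕ G ≅ G
⊕-identityˡ = game-induction _ λ G ih →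
  ≅-intro (subst₂ (ListBisim _≅_) (≡.sym (options-⊕ zeroG G)) (map-id (options G))
                  (ListBisim-pointwise ih))

⊕-cong : ∀ G H {G′ H′} → G ≅ G′ → H ≅ H′ → G ⊕ H ≅ G′ ⊕ H′
⊕-cong = game-induction _ λ G ih-G → game-induction _ λ H ih-H {_} {_} G≅G′ H≅H′ →
  ≅-intro-⊕ (ListBisim-++ (ListBisim-map (λ g∈ _ g≅g′ → ih-G g∈ H g≅g′ H≅H′) (≅-options G≅G′))
                          (ListBisim-map (λ h∈ _ h≅h′ → ih-H h∈ G≅G′ h≅h′) (≅-options H≅H′)))

options-⊕-⊕ˡ : ∀ G H K → options ((G ⊕ H) ⊕ K) ≡
               map (λ g → (g ⊕ H) ⊕ K) (options G) ++
               (map (λ h → (G ⊕ h) ⊕ K) (options H) ++ map ((G ⊕ H) ⊕_) (options K))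
options-⊕-⊕ˡ G H K = begin
  options ((G ⊕ H) ⊕ K)
    ≡⟨ options-⊕ (G ⊕ H) K ⟩
  map (_⊕ K) (options (G ⊕ H)) ++ Ks
    ≡⟨ cong (λ xs → map (_⊕ K) xs ++ Ks) (options-⊕ G H) ⟩
  map (_⊕ K) (map (_⊕ H) (options G) ++ map (G ⊕_) (options H)) ++ Ks
    ≡⟨ cong (_++ Ks) (map-++ (_⊕ K) (map (_⊕ H) (options G)) _) ⟩
  (map (_⊕ K) (map (_⊕ H) (options G)) ++ map (_⊕ K) (map (G ⊕_) (options H))) ++ Ks
    ≡⟨ ++-assoc (map (_⊕ K) (map (_⊕ H) (options G))) _ Ks ⟩
  map (_⊕ K) (map (_⊕ H) (options G)) ++ (map (_⊕ K) (map (G ⊕_) (options H)) ++ Ks)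
    ≡⟨ ≡.sym (cong₂ (λ xs ys → xs ++ (ys ++ Ks)) (map-∘ (options G)) (map-∘ (options H))) ⟩
  map (λ g → (g ⊕ H) ⊕ K) (options G) ++ (map (λ h → (G ⊕ h) ⊕ K) (options H) ++ Ks) ∎
  where
  open ≡-Reasoning
  Ks : List Game
  Ks = map ((G ⊕ H) ⊕_) (options K)

options-⊕-⊕ʳ : ∀ G H K → options (G ⊕ (H ⊕ K)) ≡
               map (_⊕ (H ⊕ K)) (options G) ++
               (map (λ h → G ⊕ (h ⊕ K)) (options H) ++ map (λ k → G ⊕ (H ⊕ k)) (options K))
options-⊕-⊕ʳ G H K = begin
  options (G ⊕ (H ⊕ K))
    ≡⟨ options-⊕ G (H ⊕ K) ⟩
  Gs ++ map (G ⊕_) (options (H ⊕ K))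
    ≡⟨ cong (λ xs → Gs ++ map (G ⊕_) xs) (options-⊕ H K) ⟩
  Gs ++ map (G ⊕_) (map (_⊕ K) (options H) ++ map (H ⊕_) (options K))
    ≡⟨ cong (Gs ++_) (map-++ (G ⊕_) (map (_⊕ K) (options H)) _) ⟩
  Gs ++ (map (G ⊕_) (map (_⊕ K) (options H)) ++ map (G ⊕_) (map (H ⊕_) (options K)))
    ≡⟨ ≡.sym (cong₂ (λ xs ys → Gs ++ (xs ++ ys)) (map-∘ (options H)) (map-∘ (options K))) ⟩
  Gs ++ (map (λ h → G ⊕ (h ⊕ K)) (options H) ++ map (λ k → G ⊕ (H ⊕ k)) (options K)) ∎
  where
  open ≡-Reasoning
  Gs : List Game
  Gs = map (_⊕ (H ⊕ K)) (options G)

⊕-assoc : ∀ G H K → (G ⊕ H) ⊕ K ≅ G ⊕ (H ⊕ K)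
⊕-assoc = game-induction _ λ G ih-G → game-induction _ λ H ih-H → game-induction _ λ K ih-K →
  ≅-intro (subst₂ (ListBisim _≅_) (≡.sym (options-⊕-⊕ˡ G H K)) (≡.sym (options-⊕-⊕ʳ G H K))
    (ListBisim-++ (ListBisim-pointwise λ g∈ → ih-G g∈ H K)
      (ListBisim-++ (ListBisim-pointwise λ h∈ → ih-H h∈ K) (ListBisim-pointwise ih-K))))

allN-true : ∀ {g} gs → allN gs ≡ true → g ∈ gs → isP g ≡ false
allN-true (g ∷ gs) all-N (here refl) with isP g
... | false = refl
allN-true (g ∷ gs) all-N (there g′∈) with isP g
... | false = allN-true gs all-N g′∈

allN-false : ∀ gs → allN gs ≡ false → ∃ λ g → g ∈ gs × isP g ≡ true
allN-false (g ∷ gs) not-all-N with isP g in g-P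
... | true  = g , here refl , g-P
... | false = let g′ , g′∈ , g′-P = allN-false gs not-all-N in g′ , there g′∈ , g′-P

allN-cong : ∀ {R : Game → Game → Set} {gs hs} →
            (∀ {g h} → g ∈ gs → R g h → isP g ≡ isP h) → ListBisim R gs hs → allN gs ≡ allN hs
allN-cong {gs = gs} {hs} isP-resp (fw , bw) with allN gs in gs-N | allN hs in hs-N
... | true  | true  = refl
... | false | false = refl
... | true  | false = let h , h∈ , h-P = allN-false hs hs-N ; g , g∈ , r = bw h∈ in
  case ≡.trans (≡.sym (allN-true gs gs-N g∈)) (≡.trans (isP-resp g∈ r) h-P) of λ ()
... | false | true  = let g , g∈ , g-P = allN-false gs gs-N ; h , h∈ , r = fw g∈ in
  case ≡.trans (≡.sym g-P) (≡.trans (isP-resp g∈ r) (allN-true hs hs-N h∈)) of λ ()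

isP-cong : ∀ G {H} → G ≅ H → isP G ≡ isP H
isP-cong = game-induction _ step
  where
  step : ∀ G → WfRec _≺_ (λ G → ∀ {H} → G ≅ H → isP G ≡ isP H) G → ∀ {H} → G ≅ H → isP G ≡ isP H
  step (node [])       ih (node {hs = []} _)              = refl
  step (node [])       ih (node {hs = h ∷ hs} (_ , bw))   with () ← proj₁ (proj₂ (bw (here refl)))
  step (node (g ∷ gs)) ih (node {hs = []} (fw , _))       with () ← proj₁ (proj₂ (fw (here refl)))
  step (node (g ∷ gs)) ih (node {hs = h ∷ hs} bisim)      = allN-cong (λ g∈ → ih g∈) bisim

o⁻-cong : ∀ {G H} → G ≅ H → o⁻ G ≡ o⁻ H
o⁻-cong {G} {H} G≅H with isP G | isP H | isP-cong G G≅H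
... | true  | true  | _ = refl
... | false | false | _ = refl

P⇒o⁻≡𝒫 : ∀ {G} → isP G ≡ true → o⁻ G ≡ 𝒫
P⇒o⁻≡𝒫 {G} G-P with isP G
... | true = refl

nonzero-N-has-P-option : ∀ {G} → G ≢ zeroG → isP G ≡ false → ∃ λ g → g ≺ G × isP g ≡ true
nonzero-N-has-P-option {node []}       G≢0 _      = ⊥-elim (G≢0 refl)
nonzero-N-has-P-option {node (g ∷ gs)} _   G-notP = allN-false (g ∷ gs) G-notP

option-of-⊕ : ∀ {x} G H → x ≺ G ⊕ H → (∃ λ g → g ≺ G × x ≡ g ⊕ H) ⊎ (∃ λ h → h ≺ H × x ≡ G ⊕ h)
option-of-⊕ {x} G H x≺G⊕H with ∈-++⁻ (map (_⊕ H) (options G)) (subst (x ∈_) (options-⊕ G H) x≺G⊕H)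
... | inj₁ x∈ = inj₁ (∈-map⁻ (_⊕ H) x∈)
... | inj₂ x∈ = inj₂ (∈-map⁻ (G ⊕_) x∈)

module _ {𝒜 : GameSet} (closed : Closed 𝒜) where

  private
    options-closed : ∀ {G g} → 𝒜 G → g ≺ G → 𝒜 g
    options-closed = proj₂ closed _ _

  zero∈ : ∀ {G} → 𝒜 G → 𝒜 zeroG
  zero∈ {node []}       G∈ = G∈
  zero∈ {node (g ∷ gs)} G∈ = zero∈ (options-closed G∈ (here refl))

  P-position∈ : ∀ {G} → 𝒜 G → G ≢ zeroG → ∃ λ P → 𝒜 P × isP P ≡ true
  P-position∈ {G} G∈ G≢0 with isP G in G-P
  ... | true  = G , G∈ , G-P
  ... | false = let g , g≺G , g-P = nonzero-N-has-P-option G≢0 G-P in g , options-closed G∈ g≺G , g-P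

  P-complement : (∃ λ P → 𝒜 P × isP P ≡ true) → ∀ S → 𝒜 S → ∃ λ Y → 𝒜 Y × isP (S ⊕ Y) ≡ true
  P-complement (P , P∈ , P-P) (node []) _ = P , P∈ , ≡.trans (isP-cong _ (⊕-identityˡ P)) P-P
  P-complement _ S@(node (_ ∷ _)) S∈ with isP (S ⊕ S) in SS-P
  ... | true  = S , S∈ , SS-P
  ... | false with nonzero-N-has-P-option {S ⊕ S} (λ ()) SS-P
  ...   | x , x≺S⊕S , x-P with option-of-⊕ S S x≺S⊕S
  ...     | inj₁ (s , s≺S , refl) = s , options-closed S∈ s≺S , ≡.trans (isP-cong _ (⊕-comm S s)) x-P
  ...     | inj₂ (s , s≺S , refl) = s , options-closed S∈ s≺S , x-P

module _ (𝒜 : GameSet) where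

  ≡[]-setoid : Setoid 0ℓ 0ℓ
  ≡[]-setoid = record
    { Carrier       = Game
    ; _≈_           = λ G H → G ≡[ 𝒜 ] H
    ; isEquivalence = record
      { refl  = λ X X∈ → refl
      ; sym   = λ G≡H X X∈ → ≡.sym (G≡H X X∈)
      ; trans = λ G≡H H≡K X X∈ → ≡.trans (G≡H X X∈) (H≡K X X∈)
      }
    }

  ≅⇒≡[] : ∀ {G H} → G ≅ H → G ≡[ 𝒜 ] H
  ≅⇒≡[] {G} G≅H X _ = o⁻-cong (⊕-cong G X G≅H (≅-refl X))

module MisereQuotient (𝒜 : GameSet) (closed : Closed 𝒜) (0∈𝒜 : 𝒜 zeroG) where

  open Setoid (≡[]-setoid 𝒜) using (isEquivalence)
  open import Relation.Binary.Reasoning.Setoid (≡[]-setoid 𝒜)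

  ⊕-congʳ-≡[] : ∀ {G H K} → 𝒜 K → G ≡[ 𝒜 ] H → (G ⊕ K) ≡[ 𝒜 ] (H ⊕ K)
  ⊕-congʳ-≡[] {G} {H} {K} K∈ G≡H X X∈ =
    ≡.trans (o⁻-cong (⊕-assoc G K X))
          (≡.trans (G≡H (K ⊕ X) (proj₁ closed K X K∈ X∈)) (≡.sym (o⁻-cong (⊕-assoc H K X))))

  ⊕-cong-≡[] : ∀ {G H K L} → 𝒜 H → 𝒜 K → G ≡[ 𝒜 ] H → K ≡[ 𝒜 ] L → (G ⊕ K) ≡[ 𝒜 ] (H ⊕ L)
  ⊕-cong-≡[] {G} {H} {K} {L} H∈ K∈ G≡H K≡L = begin
    G ⊕ K  ≈⟨ ⊕-congʳ-≡[] {G} {H} K∈ G≡H ⟩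
    H ⊕ K  ≈⟨ ≅⇒≡[] 𝒜 (⊕-comm H K) ⟩
    K ⊕ H  ≈⟨ ⊕-congʳ-≡[] {K} {L} H∈ K≡L ⟩
    L ⊕ H  ≈⟨ ≅⇒≡[] 𝒜 (⊕-comm L H) ⟩
    H ⊕ L  ∎

  𝒬 : CommutativeMonoid 0ℓ 0ℓ
  𝒬 = record
    { Carrier             = Σ Game 𝒜
    ; _≈_                 = (λ G H → G ≡[ 𝒜 ] H) on proj₁
    ; _∙_                 = λ (G , G∈) (H , H∈) → G ⊕ H , proj₁ closed G H G∈ H∈
    ; ε                   = zeroG , 0∈𝒜
    ; isCommutativeMonoid = isCommutativeMonoidˡ record
      { isSemigroup = record
        { isMagma = record
          { isEquivalence = On.isEquivalence proj₁ isEquivalence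
          ; ∙-cong        = λ {(G , _)} {(H , H∈)} {(K , K∈)} {(L , _)} → ⊕-cong-≡[] {G} {H} {K} {L} H∈ K∈
          }
        ; assoc = λ (G , _) (H , _) (K , _) → ≅⇒≡[] 𝒜 (⊕-assoc G H K)
        }
      ; identityˡ = λ (G , _) → ≅⇒≡[] 𝒜 (⊕-identityˡ G)
      ; comm      = λ (G , _) (H , _) → ≅⇒≡[] 𝒜 (⊕-comm G H)
      }
    }

  open CommutativeMonoid 𝒬 using (Carrier; _≈_; _∙_; rawMagma)
  open import Algebra.Definitions _≈_ using (_IdempotentOn_)
  open import Algebra.Definitions.RawMagma rawMagma using (_∣ˡ_; _,_)
  open import Algebra.Properties.CommutativeMonoid.Sum 𝒬 using (sum)

  classes : ∀ {k} {e : Fin k → Game} → (∀ i → 𝒜 (e i)) → Vector Carrier k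
  classes e∈ i = _ , e∈ i

  classes-cover : ∀ {n} {r : Fin n → Game} (r∈ : ∀ i → 𝒜 (r i)) →
                  (∀ G → 𝒜 G → ∃ λ i → G ≡[ 𝒜 ] r i) → ∀ x → ∃ λ i → x ≈ classes r∈ i
  classes-cover r∈ covers (G , G∈) = covers G G∈

  classes-cover-idempotents : ∀ {k} {e : Fin k → Game} (e∈ : ∀ i → 𝒜 (e i)) →
                              (∀ G → 𝒜 G → Idempotent 𝒜 G → ∃ λ i → G ≡[ 𝒜 ] e i) →
                              ∀ x → _∙_ IdempotentOn x → ∃ λ i → x ≈ classes e∈ i
  classes-cover-idempotents e∈ complete (G , G∈) = complete G G∈

  ∣ˡ⇒Divides : ∀ {x y} → x ∣ˡ y → Divides 𝒜 (proj₁ x) (proj₁ y)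
  ∣ˡ⇒Divides ((W , W∈) , xW≡y) = W , W∈ , xW≡y

  sum-classes : ∀ k {e : Fin k → Game} (e∈ : ∀ i → 𝒜 (e i)) → proj₁ (sum (classes e∈)) ≡ sumFin k e
  sum-classes zero    e∈ = refl
  sum-classes (suc k) e∈ = cong (_ ⊕_) (sum-classes k (λ i → e∈ (Fin.suc i)))

mainTheorem17 : (𝒜 : GameSet) → Closed 𝒜 → (∃ λ G → 𝒜 G)
    → (∃ λ G → 𝒜 G × G ≢ zeroG) → FiniteQuotient 𝒜
    → (k : ℕ) (e : Fin k → Game) → IdempotentEnumeration 𝒜 k e
    → ∃ λ K → 𝒜 K × MutuallyDivisible 𝒜 K (sumFin k e) × o⁻ K ≡ 𝒫
mainTheorem17 𝒜 closed (G , G∈) (H , H∈ , H≢0) (n , r , r∈ , covers) k e (e-idempotent , _ , e-complete) =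
  proj₁ K , proj₂ K ,
  subst (MutuallyDivisible 𝒜 (proj₁ K)) (sum-classes k e∈) (∣ˡ⇒Divides (z∙y∣ˡz y) , ∣ˡ⇒Divides (x∣ˡxy z y)) ,
  P⇒o⁻≡𝒫 {proj₁ K} (proj₂ (proj₂ complement))
  where
  open MisereQuotient 𝒜 closed (zero∈ closed G∈)
  open CommutativeMonoid 𝒬 using (Carrier; _∙_; magma)
  open import Algebra.Properties.Magma.Divisibility magma using (x∣ˡxy)

  e∈ : ∀ i → 𝒜 (e i)
  e∈ i = proj₁ (e-idempotent i)

  open IdempotentSum 𝒬 (classes r∈) (classes-cover r∈ covers) (classes e∈) (classes-cover-idempotents e∈ e-complete)

  complement : ∃ λ Y → 𝒜 Y × isP (proj₁ z ⊕ Y) ≡ true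
  complement = P-complement closed (P-position∈ closed H∈ H≢0) (proj₁ z) (proj₂ z)

  y : Carrier
  y = proj₁ complement , proj₁ (proj₂ complement)

  K : Carrier
  K = z ∙ y
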